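{- Let $r$ be an integer and for integers $0\le k\le n$ put $$T(n,k,r)=\sum_{j=0}^{n-k}\binom{k}{j}\binom{n-k}{j}r^j.$$ Let $a(n,r)=T(2n,n,r)$ for $n\ge 0$. Then the Hankel transform of the sequence $(a(n,r))_{n\ge 0}$ is given by $$h_n=2^n\, r^{\binom{n+1}{2}}\qquad (n\ge 0).$$
   Context: The Hankel transform of a sequence $(a_n)_{n\ge 0}$ is the sequence $(h_n)_{n\ge 0}$ with $h_n=\det\big(a_{i+j}\big)_{0\le i,j\le n}$. The convention $0^0=1$ is used. -}

module Defs where

open import Data.Nat as ℕ using (ℕ; zero; suc; _∸_)
open import Data.Nat.Combinatorics using (_C_)
open import Data.Integer using (ℤ; +_; _+_; _*_; -_; _^_; 0ℤ; 1ℤ)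
open import Data.Fin using (Fin; zero; suc; toℕ; punchIn)

∑ : (n : ℕ) → (Fin n → ℤ) → ℤ
∑ zero    f = 0ℤ
∑ (suc n) f = f zero + ∑ n (λ i → f (suc i))

∑≤ : ℕ → (ℕ → ℤ) → ℤ
∑≤ m f = ∑ (suc m) (λ j → f (toℕ j))

sgn : ℕ → ℤ
sgn zero          = 1ℤ
sgn (suc zero)    = - 1ℤ
sgn (suc (suc k)) = sgn k

Matrix : ℕ → Set
Matrix n = Fin n → Fin n → ℤ

minor : ∀ {n} → Matrix (suc n) → Fin (suc n) → Matrix n
minor M j r c = M (suc r) (punchIn j c)

det : (n : ℕ) → Matrix n → ℤ
det zero    M = 1ℤ
det (suc n) M = ∑ (suc n) (λ j → sgn (toℕ j) * (M zero j * det n (minor M j)))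

hankel : (ℕ → ℤ) → ℕ → ℤ
hankel a n = det (suc n) (λ i j → a (toℕ i ℕ.+ toℕ j))

-- T(n,k,r) = Σ_{j=0}^{n-k} C(k,j) C(n-k,j) r^j   (with 0^0 = 1, as _^_ gives).
T : ℕ → ℕ → ℤ → ℤ
T n k r = ∑≤ (n ∸ k) (λ j → + (k C j) * (+ ((n ∸ k) C j) * (r ^ j)))

a : ℤ → ℕ → ℤ
a r n = T (2 ℕ.* n) n r

{-# OPTIONS --safe #-}
-- Let c i m be the coefficient of x^m in ((1 + x) (1 + r/x))^i = (x + 1 + r + r/x)^i, that is
-- c i m = Σ_b C(i, m+b) C(i, b) r^b, so that a(n) = c n 0 and c 0 is the first unit vector.
-- Multiplying by x + 1 + r + r/x gives c (i+1) = J (c i) for the tridiagonal operator J with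
-- subdiagonal 1, diagonal 1 + r and superdiagonal 2r, r, r, ...  With the weights w 0 = 1,
-- w m = 2 r^m, J is self-adjoint for ⟨u, v⟩ = Σ_m w m u m v m, hence
-- ⟨c i, c j⟩ = ⟨c (i+j), c 0⟩ = a(i+j).  The Hankel matrix is therefore L U with L i m = w m c i m
-- lower triangular with diagonal w and U m j = c j m upper unitriangular, and its determinant
-- is w 0 ⋯ w n = 2^n r^C(n+1,2).
module Submission where

open import Defs
open import Data.Nat as ℕ using (ℕ; zero; suc)
import Data.Nat.Properties as ℕ
open import Data.Nat.Combinatorics using (_C_; nC1≡n; nCn≡1; nCk+nC[k+1]≡[n+1]C[k+1]; k>n⇒nCk≡0)
open import Data.Integer using (ℤ; +_; +0; +[1+_]; -[1+_]; _+_; _*_; -_; _^_; 0ℤ; 1ℤ)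
import Data.Integer.Properties as ℤ
open import Data.Integer.Tactic.RingSolver using (solve-∀)
open import Data.Fin using (Fin; zero; suc; toℕ; fromℕ; fromℕ<; inject₁; punchIn; punchOut)
import Data.Fin.Properties as Fin
open import Data.Fin.Permutation.Components using (transpose)
import Data.Fin.Permutation as Perm
open import Data.Vec.Functional using (updateAt)
open import Data.Vec.Functional.Properties using (updateAt-updates; updateAt-minimal; updateAt-id-local)
import Algebra.Properties.CommutativeMonoid.Sum ℤ.+-0-commutativeMonoid as ∑ℤ
open import Algebra.Properties.CommutativeMonoid.Sum ℤ.*-1-commutativeMonoid
  using () renaming (sum to ∏; sum-init-last to ∏-init-last; sum-cong-≗ to ∏-cong)
open import Data.Empty using (⊥-elim)
open import Data.Product using (_×_; _,_; proj₁; proj₂)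
open import Data.Sum using (_⊎_; inj₁; inj₂)
open import Function using (_∘_)
open import Relation.Binary.Definitions using (tri<; tri≈; tri>)
open import Relation.Binary.PropositionalEquality
  using (_≡_; _≢_; _≗_; refl; sym; trans; cong; cong₂; subst; module ≡-Reasoning)
open import Relation.Nullary using (¬_)
open import Relation.Nullary.Decidable using (Dec; yes; no; dec-true; dec-false)
open ≡-Reasoning

∑-cong : ∀ n {f g : Fin n → ℤ} → f ≗ g → ∑ n f ≡ ∑ n g
∑-cong zero    f≗g = refl
∑-cong (suc n) f≗g = cong₂ _+_ (f≗g zero) (∑-cong n (f≗g ∘ suc))

∑-zero : ∀ n {f : Fin n → ℤ} → (∀ i → f i ≡ 0ℤ) → ∑ n f ≡ 0ℤ
∑-zero zero    f≗0 = refl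
∑-zero (suc n) f≗0 = cong₂ _+_ (f≗0 zero) (∑-zero n (f≗0 ∘ suc))

∑≡sum : ∀ n (f : Fin n → ℤ) → ∑ n f ≡ ∑ℤ.sum f
∑≡sum zero    f = refl
∑≡sum (suc n) f = cong (_+_ (f zero)) (∑≡sum n (f ∘ suc))

∑-neg : ∀ n (f : Fin n → ℤ) → ∑ n (λ i → - f i) ≡ - ∑ n f
∑-neg zero    f = refl
∑-neg (suc n) f = trans (cong (_+_ (- f zero)) (∑-neg n (f ∘ suc))) (sym (ℤ.neg-distrib-+ (f zero) _))

∑-distrib-+ : ∀ n (f g : Fin n → ℤ) → ∑ n (λ i → f i + g i) ≡ ∑ n f + ∑ n g
∑-distrib-+ n f g = begin
  ∑ n (λ i → f i + g i)         ≡⟨ ∑≡sum n _ ⟩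
  ∑ℤ.sum (λ i → f i + g i)      ≡⟨ ∑ℤ.∑-distrib-+ f g ⟩
  ∑ℤ.sum f + ∑ℤ.sum g           ≡⟨ cong₂ _+_ (∑≡sum n f) (∑≡sum n g) ⟨
  ∑ n f + ∑ n g                 ∎

*-distribˡ-∑ : ∀ n x (f : Fin n → ℤ) → x * ∑ n f ≡ ∑ n (λ i → x * f i)
*-distribˡ-∑ zero    x f = ℤ.*-zeroʳ x
*-distribˡ-∑ (suc n) x f = trans (ℤ.*-distribˡ-+ x (f zero) _) (cong (_+_ (x * f zero)) (*-distribˡ-∑ n x (f ∘ suc)))

∑-transpose : ∀ n (f : Fin n → ℤ) (i j : Fin n) → ∑ n (f ∘ transpose i j) ≡ ∑ n f
∑-transpose n f i j = begin
  ∑ n (f ∘ transpose i j)      ≡⟨ ∑≡sum n _ ⟩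
  ∑ℤ.sum (f ∘ transpose i j)   ≡⟨ ∑ℤ.sum-permute f (Perm.transpose i j) ⟨
  ∑ℤ.sum f                     ≡⟨ ∑≡sum n f ⟨
  ∑ n f                        ∎

∑-single : ∀ n (f : Fin n → ℤ) (k : Fin n) → (∀ i → i ≢ k → f i ≡ 0ℤ) → ∑ n f ≡ f k
∑-single (suc n) f k f≗0 = begin
  ∑ (suc n) f                        ≡⟨ ∑≡sum (suc n) f ⟩
  ∑ℤ.sum f                           ≡⟨ ∑ℤ.sum-remove f ⟩
  f k + ∑ℤ.sum (f ∘ punchIn k)       ≡⟨ cong (_+_ (f k)) (∑≡sum n (f ∘ punchIn k)) ⟨
  f k + ∑ n (f ∘ punchIn k)          ≡⟨ cong (_+_ (f k)) (∑-zero n (λ i → f≗0 _ (Fin.punchInᵢ≢i k i))) ⟩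
  f k + 0ℤ                           ≡⟨ ℤ.+-identityʳ (f k) ⟩
  f k                                ∎

∑-dropLast : ∀ n (f : ℕ → ℤ) → f n ≡ 0ℤ → ∑ (suc n) (f ∘ toℕ) ≡ ∑ n (f ∘ toℕ)
∑-dropLast zero    f f0≡0 = trans (ℤ.+-identityʳ (f 0)) f0≡0
∑-dropLast (suc n) f fn≡0 = cong (_+_ (f 0)) (∑-dropLast n (f ∘ suc) fn≡0)

∑-truncate : ∀ n d (f : ℕ → ℤ) → (∀ m → n ℕ.≤ m → f m ≡ 0ℤ) → ∑ (n ℕ.+ d) (f ∘ toℕ) ≡ ∑ n (f ∘ toℕ)
∑-truncate zero    d f f≡0 = ∑-zero d (λ i → f≡0 (toℕ i) ℕ.z≤n)
∑-truncate (suc n) d f f≡0 = cong (_+_ (f 0)) (∑-truncate n d (f ∘ suc) (λ m n≤m → f≡0 (suc m) (ℕ.s≤s n≤m)))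

transpose-matchˡ : ∀ {n} (i j : Fin n) → transpose i j i ≡ j
transpose-matchˡ i j rewrite dec-true (i Fin.≟ i) refl = refl

transpose-matchʳ : ∀ {n} (i j : Fin n) → transpose i j j ≡ i
transpose-matchʳ i j with j Fin.≟ i
... | yes refl = refl
... | no _ rewrite dec-true (j Fin.≟ j) refl = refl

transpose-other : ∀ {n} {i j k : Fin n} → k ≢ i → k ≢ j → transpose i j k ≡ k
transpose-other {i = i} {j} {k} k≢i k≢j rewrite dec-false (k Fin.≟ i) k≢i | dec-false (k Fin.≟ j) k≢j = refl

punchIn≡⇒≡punchOut : ∀ {n} {j c : Fin (suc n)} {x : Fin n} (j≢c : j ≢ c) → punchIn j x ≡ c → x ≡ punchOut j≢c
punchIn≡⇒≡punchOut {j = j} {x = x} j≢c eq = Fin.punchIn-injective j x _ (trans eq (sym (Fin.punchIn-punchOut j≢c)))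

-- The case splits below take the Dec as an argument: a with would also abstract the
-- identical test inside transpose and change the goal.
transpose-punchIn : ∀ {n} {j c c′ : Fin (suc n)} (j≢c : j ≢ c) (j≢c′ : j ≢ c′) x →
  transpose c c′ (punchIn j x) ≡ punchIn j (transpose (punchOut j≢c) (punchOut j≢c′) x)
transpose-punchIn {j = j} {c} {c′} j≢c j≢c′ x = by-cases (x Fin.≟ punchOut j≢c) (x Fin.≟ punchOut j≢c′)
  where
  τ′ = transpose (punchOut j≢c) (punchOut j≢c′)
  by-cases : Dec (x ≡ punchOut j≢c) → Dec (x ≡ punchOut j≢c′) → transpose c c′ (punchIn j x) ≡ punchIn j (τ′ x)
  by-cases (yes refl) _ = begin
    transpose c c′ (punchIn j (punchOut j≢c))    ≡⟨ cong (transpose c c′) (Fin.punchIn-punchOut j≢c) ⟩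
    transpose c c′ c                             ≡⟨ transpose-matchˡ c c′ ⟩
    c′                                           ≡⟨ Fin.punchIn-punchOut j≢c′ ⟨
    punchIn j (punchOut j≢c′)                    ≡⟨ cong (punchIn j) (transpose-matchˡ (punchOut j≢c) (punchOut j≢c′)) ⟨
    punchIn j (τ′ (punchOut j≢c))                ∎
  by-cases (no _) (yes refl) = begin
    transpose c c′ (punchIn j (punchOut j≢c′))   ≡⟨ cong (transpose c c′) (Fin.punchIn-punchOut j≢c′) ⟩
    transpose c c′ c′                            ≡⟨ transpose-matchʳ c c′ ⟩
    c                                            ≡⟨ Fin.punchIn-punchOut j≢c ⟨
    punchIn j (punchOut j≢c)                     ≡⟨ cong (punchIn j) (transpose-matchʳ (punchOut j≢c) (punchOut j≢c′)) ⟨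
    punchIn j (τ′ (punchOut j≢c′))               ∎
  by-cases (no x≢c) (no x≢c′) = begin
    transpose c c′ (punchIn j x)                 ≡⟨ transpose-other (x≢c ∘ punchIn≡⇒≡punchOut j≢c) (x≢c′ ∘ punchIn≡⇒≡punchOut j≢c′) ⟩
    punchIn j x                                  ≡⟨ cong (punchIn j) (transpose-other x≢c x≢c′) ⟨
    punchIn j (τ′ x)                             ∎

punchOut-adjacent : ∀ {n} {j c c′ : Fin (suc n)} (j≢c : j ≢ c) (j≢c′ : j ≢ c′) →
  toℕ c′ ≡ suc (toℕ c) → toℕ (punchOut j≢c′) ≡ suc (toℕ (punchOut j≢c))
punchOut-adjacent {j = zero} {zero} j≢c _ _ = ⊥-elim (j≢c refl)
punchOut-adjacent {j = zero} {suc c} {zero} _ j≢c′ _ = ⊥-elim (j≢c′ refl)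
punchOut-adjacent {j = zero} {suc c} {suc c′} _ _ adj = ℕ.suc-injective adj
punchOut-adjacent {suc n} {suc j} {zero} {zero} _ _ ()
punchOut-adjacent {suc n} {suc zero} {zero} {suc zero} _ j≢c′ _ = ⊥-elim (j≢c′ refl)
punchOut-adjacent {suc (suc n)} {suc (suc j)} {zero} {suc zero} _ _ _ = refl
punchOut-adjacent {suc n} {suc j} {zero} {suc (suc c′)} _ _ ()
punchOut-adjacent {suc n} {suc j} {suc c} {zero} _ _ ()
punchOut-adjacent {suc n} {suc j} {suc c} {suc c′} j≢c j≢c′ adj =
  cong suc (punchOut-adjacent (j≢c ∘ cong suc) (j≢c′ ∘ cong suc) (ℕ.suc-injective adj))

punchIn-adjacent : ∀ {n} {c c′ : Fin (suc n)} → toℕ c′ ≡ suc (toℕ c) → ∀ x →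
  punchIn c x ≡ punchIn c′ x ⊎ (punchIn c x ≡ c′ × punchIn c′ x ≡ c)
punchIn-adjacent {c = zero} {zero} () x
punchIn-adjacent {c = zero} {suc zero} _ zero = inj₂ (refl , refl)
punchIn-adjacent {c = zero} {suc zero} _ (suc x) = inj₁ refl
punchIn-adjacent {c = zero} {suc (suc c′)} () x
punchIn-adjacent {c = suc c} {zero} () x
punchIn-adjacent {c = suc c} {suc c′} _ zero = inj₁ refl
punchIn-adjacent {c = suc c} {suc c′} adj (suc x) with punchIn-adjacent (ℕ.suc-injective adj) x
... | inj₁ eq = inj₁ (cong suc eq)
... | inj₂ (eq₁ , eq₂) = inj₂ (cong suc eq₁ , cong suc eq₂)

transpose-punchIn-adjacent : ∀ {n} {c c′ : Fin (suc n)} → toℕ c′ ≡ suc (toℕ c) → ∀ x →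
  transpose c c′ (punchIn c x) ≡ punchIn c′ x × transpose c c′ (punchIn c′ x) ≡ punchIn c x
transpose-punchIn-adjacent {c = c} {c′} adj x with punchIn-adjacent adj x
... | inj₁ eq =
  trans (transpose-other (Fin.punchInᵢ≢i c x) (Fin.punchInᵢ≢i c′ x ∘ trans (sym eq))) eq ,
  trans (transpose-other (Fin.punchInᵢ≢i c x ∘ trans eq) (Fin.punchInᵢ≢i c′ x)) (sym eq)
... | inj₂ (eq₁ , eq₂) =
  trans (cong (transpose c c′) eq₁) (trans (transpose-matchʳ c c′) (sym eq₂)) ,
  trans (cong (transpose c c′) eq₂) (trans (transpose-matchˡ c c′) (sym eq₁))

-- Determinants

sgn-suc : ∀ k → sgn (suc k) ≡ - sgn k
sgn-suc zero          = refl
sgn-suc (suc zero)    = refl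
sgn-suc (suc (suc k)) = sgn-suc k

laplaceTerm : ∀ {n} → Matrix (suc n) → Fin (suc n) → ℤ
laplaceTerm {n} M j = sgn (toℕ j) * (M zero j * det n (minor M j))

det-cong : ∀ n {M N : Matrix n} → (∀ r c → M r c ≡ N r c) → det n M ≡ det n N
det-cong zero    M≗N = refl
det-cong (suc n) M≗N = ∑-cong (suc n) λ j →
  cong₂ (λ x y → sgn (toℕ j) * (x * y)) (M≗N zero j) (det-cong n (λ r c → M≗N (suc r) (punchIn j c)))

laplaceTerm-linearAt : ∀ {n} (k : Fin (suc n)) (x y : ℤ) {M A B : Matrix (suc n)} →
  (∀ r c → c ≢ k → A r c ≡ M r c) → (∀ r c → c ≢ k → B r c ≡ M r c) →
  (∀ r → M r k ≡ x * A r k + y * B r k) →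
  laplaceTerm M k ≡ x * laplaceTerm A k + y * laplaceTerm B k
laplaceTerm-linearAt {n} k x y {M} {A} {B} A≈M B≈M Mₖ = begin
  s * (M zero k * det n (minor M k))                           ≡⟨ cong (λ m → s * (m * det n (minor M k))) (Mₖ zero) ⟩
  s * ((x * A zero k + y * B zero k) * det n (minor M k))      ≡⟨ distrib s x y (A zero k) (B zero k) _ ⟩
  x * (s * (A zero k * det n (minor M k))) + y * (s * (B zero k * det n (minor M k)))
    ≡⟨ cong₂ (λ a b → x * (s * (A zero k * a)) + y * (s * (B zero k * b)))
             (det-cong n (λ r c → sym (A≈M (suc r) (punchIn k c) (Fin.punchInᵢ≢i k c))))
             (det-cong n (λ r c → sym (B≈M (suc r) (punchIn k c) (Fin.punchInᵢ≢i k c)))) ⟩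
  x * laplaceTerm A k + y * laplaceTerm B k                    ∎
  where
  s = sgn (toℕ k)
  distrib : ∀ s x y a b d → s * ((x * a + y * b) * d) ≡ x * (s * (a * d)) + y * (s * (b * d))
  distrib = solve-∀

det-linearInColumn : ∀ n (k : Fin n) (x y : ℤ) {M A B : Matrix n} →
  (∀ r c → c ≢ k → A r c ≡ M r c) → (∀ r c → c ≢ k → B r c ≡ M r c) →
  (∀ r → M r k ≡ x * A r k + y * B r k) →
  det n M ≡ x * det n A + y * det n B
det-linearInColumn (suc n) k x y {M} {A} {B} A≈M B≈M Mₖ = begin
  ∑ (suc n) (laplaceTerm M)                                         ≡⟨ ∑-cong (suc n) term ⟩
  ∑ (suc n) (λ j → x * laplaceTerm A j + y * laplaceTerm B j)
    ≡⟨ ∑-distrib-+ (suc n) (λ j → x * laplaceTerm A j) (λ j → y * laplaceTerm B j) ⟩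
  ∑ (suc n) (λ j → x * laplaceTerm A j) + ∑ (suc n) (λ j → y * laplaceTerm B j)
    ≡⟨ cong₂ _+_ (*-distribˡ-∑ (suc n) x (laplaceTerm A)) (*-distribˡ-∑ (suc n) y (laplaceTerm B)) ⟨
  x * det (suc n) A + y * det (suc n) B                             ∎
  where
  term : ∀ j → laplaceTerm M j ≡ x * laplaceTerm A j + y * laplaceTerm B j
  term j with j Fin.≟ k
  ... | yes refl = laplaceTerm-linearAt j x y A≈M B≈M Mₖ
  ... | no j≢k = begin
    s * (M zero j * det n (minor M j))                           ≡⟨ cong (λ d → s * (M zero j * d)) minor-linear ⟩
    s * (M zero j * (x * det n (minor A j) + y * det n (minor B j))) ≡⟨ distrib s (M zero j) x y _ _ ⟩
    x * (s * (M zero j * det n (minor A j))) + y * (s * (M zero j * det n (minor B j)))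
      ≡⟨ cong₂ (λ a b → x * (s * (a * det n (minor A j))) + y * (s * (b * det n (minor B j))))
               (sym (A≈M zero j j≢k)) (sym (B≈M zero j j≢k)) ⟩
    x * laplaceTerm A j + y * laplaceTerm B j                    ∎
    where
    s = sgn (toℕ j)
    distrib : ∀ s m x y a b → s * (m * (x * a + y * b)) ≡ x * (s * (m * a)) + y * (s * (m * b))
    distrib = solve-∀
    minor-linear : det n (minor M j) ≡ x * det n (minor A j) + y * det n (minor B j)
    minor-linear = det-linearInColumn n (punchOut j≢k) x y
      (λ r c c≢k′ → A≈M (suc r) (punchIn j c) (c≢k′ ∘ punchIn≡⇒≡punchOut j≢k))
      (λ r c c≢k′ → B≈M (suc r) (punchIn j c) (c≢k′ ∘ punchIn≡⇒≡punchOut j≢k))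
      (λ r → subst (λ c → M (suc r) c ≡ x * A (suc r) c + y * B (suc r) c)
                   (sym (Fin.punchIn-punchOut j≢k)) (Mₖ (suc r)))

setColumn : ∀ {n} → Matrix n → Fin n → (Fin n → ℤ) → Matrix n
setColumn M k v r = updateAt (M r) k (λ _ → v r)

det-setColumn-∑ : ∀ n (M : Matrix n) k p (x : Fin p → ℤ) (G : Fin p → Fin n → ℤ) →
  det n (setColumn M k (λ r → ∑ p (λ m → x m * G m r))) ≡ ∑ p (λ m → x m * det n (setColumn M k (G m)))
det-setColumn-∑ n M k zero x G =
  det-linearInColumn n k 0ℤ 0ℤ {A = M} {B = M} unchanged unchanged (λ r → updateAt-updates k (M r))
  where
  unchanged : ∀ r c → c ≢ k → M r c ≡ setColumn M k (λ _ → 0ℤ) r c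
  unchanged r c c≢k = sym (updateAt-minimal c k (M r) c≢k)
det-setColumn-∑ n M k (suc p) x G = begin
  det n (setColumn M k (λ r → x zero * G zero r + rest r))
    ≡⟨ det-linearInColumn n k (x zero) 1ℤ (agree (G zero)) (agree rest) column-k ⟩
  x zero * det n (setColumn M k (G zero)) + 1ℤ * det n (setColumn M k rest)
    ≡⟨ cong (_+_ (x zero * det n (setColumn M k (G zero)))) (ℤ.*-identityˡ _) ⟩
  x zero * det n (setColumn M k (G zero)) + det n (setColumn M k rest)
    ≡⟨ cong (_+_ (x zero * det n (setColumn M k (G zero)))) (det-setColumn-∑ n M k p (x ∘ suc) (G ∘ suc)) ⟩
  ∑ (suc p) (λ m → x m * det n (setColumn M k (G m))) ∎
  where
  rest : Fin n → ℤ
  rest r = ∑ p (λ m → x (suc m) * G (suc m) r)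
  agree : ∀ v r c → c ≢ k → setColumn M k v r c ≡ setColumn M k (λ r → x zero * G zero r + rest r) r c
  agree v r c c≢k = trans (updateAt-minimal c k (M r) c≢k) (sym (updateAt-minimal c k (M r) c≢k))
  column-k : ∀ r → setColumn M k (λ r → x zero * G zero r + rest r) r k ≡
                   x zero * setColumn M k (G zero) r k + 1ℤ * setColumn M k rest r k
  column-k r = begin
    setColumn M k (λ r → x zero * G zero r + rest r) r k  ≡⟨ updateAt-updates k (M r) ⟩
    x zero * G zero r + rest r                            ≡⟨ cong₂ (λ a b → x zero * a + b) (updateAt-updates k (M r)) (ℤ.*-identityˡ _) ⟨
    x zero * setColumn M k (G zero) r k + 1ℤ * rest r
      ≡⟨ cong (λ b → x zero * setColumn M k (G zero) r k + 1ℤ * b) (updateAt-updates k (M r)) ⟨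
    x zero * setColumn M k (G zero) r k + 1ℤ * setColumn M k rest r k ∎

swapColumns : ∀ {n} → Matrix n → Fin n → Fin n → Matrix n
swapColumns M c c′ r x = M r (transpose c c′ x)

-- Expanding along the first row, the terms of columns c and c′ trade places with opposite
-- signs, and every other minor is itself an adjacent swap of the corresponding minor of M.
det-swapAdjacent : ∀ n (M : Matrix n) {c c′ : Fin n} → toℕ c′ ≡ suc (toℕ c) →
  det n (swapColumns M c c′) ≡ - det n M
det-swapAdjacent (suc n) M {c} {c′} adj = begin
  ∑ (suc n) (laplaceTerm M′)                           ≡⟨ ∑-cong (suc n) (λ j → term j (j Fin.≟ c) (j Fin.≟ c′)) ⟩
  ∑ (suc n) (λ j → - laplaceTerm M (transpose c c′ j))  ≡⟨ ∑-neg (suc n) (laplaceTerm M ∘ transpose c c′) ⟩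
  - ∑ (suc n) (laplaceTerm M ∘ transpose c c′)         ≡⟨ cong -_ (∑-transpose (suc n) (laplaceTerm M) c c′) ⟩
  - det (suc n) M                                      ∎
  where
  M′ = swapColumns M c c′
  τ = transpose c c′
  sgn-c′ : sgn (toℕ c′) ≡ - sgn (toℕ c)
  sgn-c′ = trans (cong sgn adj) (sgn-suc (toℕ c))
  sgn-c : sgn (toℕ c) ≡ - sgn (toℕ c′)
  sgn-c = trans (sym (ℤ.neg-involutive _)) (cong -_ (sym sgn-c′))
  partners : ∀ j j′ → τ j ≡ j′ → sgn (toℕ j) ≡ - sgn (toℕ j′) → (∀ x → τ (punchIn j x) ≡ punchIn j′ x) →
             laplaceTerm M′ j ≡ - laplaceTerm M (τ j)
  partners j j′ τj sgn-j τ-punchIn = begin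
    sgn (toℕ j) * (M zero (τ j) * det n (minor M′ j))
      ≡⟨ cong₂ (λ s d → s * (M zero (τ j) * d)) sgn-j (det-cong n (λ r x → cong (M (suc r)) (τ-punchIn x))) ⟩
    - sgn (toℕ j′) * (M zero (τ j) * det n (minor M j′))  ≡⟨ cong (λ i → - sgn (toℕ j′) * (M zero i * det n (minor M j′))) τj ⟩
    - sgn (toℕ j′) * (M zero j′ * det n (minor M j′))     ≡⟨ ℤ.neg-distribˡ-* (sgn (toℕ j′)) _ ⟨
    - laplaceTerm M j′                                    ≡⟨ cong (λ i → - laplaceTerm M i) τj ⟨
    - laplaceTerm M (τ j)                                 ∎
  term : ∀ j → Dec (j ≡ c) → Dec (j ≡ c′) → laplaceTerm M′ j ≡ - laplaceTerm M (τ j)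
  term j (yes refl) _ = partners c c′ (transpose-matchˡ c c′) sgn-c (proj₁ ∘ transpose-punchIn-adjacent adj)
  term j (no _) (yes refl) = partners c′ c (transpose-matchʳ c c′) sgn-c′ (proj₂ ∘ transpose-punchIn-adjacent adj)
  term j (no j≢c) (no j≢c′) = begin
    sgn (toℕ j) * (M zero (τ j) * det n (minor M′ j))   ≡⟨ cong₂ (λ i d → sgn (toℕ j) * (M zero i * d)) τj≡j minor-swapped ⟩
    sgn (toℕ j) * (M zero j * - det n (minor M j))     ≡⟨ pull-neg (sgn (toℕ j)) (M zero j) (det n (minor M j)) ⟩
    - laplaceTerm M j                                  ≡⟨ cong (λ i → - laplaceTerm M i) τj≡j ⟨
    - laplaceTerm M (τ j)                              ∎
    where
    τj≡j : τ j ≡ j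
    τj≡j = transpose-other j≢c j≢c′
    pull-neg : ∀ s m d → s * (m * - d) ≡ - (s * (m * d))
    pull-neg = solve-∀
    minor-swapped : det n (minor M′ j) ≡ - det n (minor M j)
    minor-swapped = trans
      (det-cong n (λ r x → cong (M (suc r)) (transpose-punchIn j≢c j≢c′ x)))
      (det-swapAdjacent n (minor M j) (punchOut-adjacent j≢c j≢c′ adj))

i≡-i⇒i≡0 : ∀ i → i ≡ - i → i ≡ 0ℤ
i≡-i⇒i≡0 +0       _  = refl
i≡-i⇒i≡0 +[1+ n ] ()
i≡-i⇒i≡0 -[1+ n ] ()

swapColumns-equal : ∀ {n} (M : Matrix n) {c c′ : Fin n} → (∀ r → M r c ≡ M r c′) →
  ∀ r x → swapColumns M c c′ r x ≡ M r x
swapColumns-equal M {c} {c′} eq r x = by-cases (x Fin.≟ c) (x Fin.≟ c′)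
  where
  by-cases : Dec (x ≡ c) → Dec (x ≡ c′) → M r (transpose c c′ x) ≡ M r x
  by-cases (yes refl) _ = trans (cong (M r) (transpose-matchˡ c c′)) (sym (eq r))
  by-cases (no _) (yes refl) = trans (cong (M r) (transpose-matchʳ c c′)) (eq r)
  by-cases (no x≢c) (no x≢c′) = cong (M r) (transpose-other x≢c x≢c′)

-- Swapping c₂ with its left neighbour c₃ brings the two equal columns one step closer.
det-equalColumns-gap : ∀ n d (M : Matrix n) {c₁ c₂ : Fin n} →
  toℕ c₂ ≡ suc (d ℕ.+ toℕ c₁) → (∀ r → M r c₁ ≡ M r c₂) → det n M ≡ 0ℤ
det-equalColumns-gap n zero M adj eq =
  i≡-i⇒i≡0 (det n M) (trans (det-cong n (λ r x → sym (swapColumns-equal M eq r x))) (det-swapAdjacent n M adj))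
det-equalColumns-gap n (suc d) M {c₁} {c₂} gap eq =
  ℤ.neg-injective (trans (sym (det-swapAdjacent n M adj)) (det-equalColumns-gap n d M′ toℕ-c₃ eq′))
  where
  c₃<n : suc (d ℕ.+ toℕ c₁) ℕ.< n
  c₃<n = ℕ.<-trans (subst (suc (d ℕ.+ toℕ c₁) ℕ.<_) (sym gap) (ℕ.n<1+n _)) (Fin.toℕ<n c₂)
  c₃ : Fin n
  c₃ = fromℕ< c₃<n
  toℕ-c₃ : toℕ c₃ ≡ suc (d ℕ.+ toℕ c₁)
  toℕ-c₃ = Fin.toℕ-fromℕ< c₃<n
  adj : toℕ c₂ ≡ suc (toℕ c₃)
  adj = trans gap (cong suc (sym toℕ-c₃))
  M′ = swapColumns M c₃ c₂
  eq′ : ∀ r → M′ r c₁ ≡ M′ r c₃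
  eq′ r = begin
    M r (transpose c₃ c₂ c₁)  ≡⟨ cong (M r) (transpose-other c₁≢c₃ c₁≢c₂) ⟩
    M r c₁                    ≡⟨ eq r ⟩
    M r c₂                    ≡⟨ cong (M r) (transpose-matchˡ c₃ c₂) ⟨
    M r (transpose c₃ c₂ c₃)  ∎
    where
    c₁≢c₃ : c₁ ≢ c₃
    c₁≢c₃ c₁≡c₃ = ℕ.m≢1+n+m (toℕ c₁) (trans (cong toℕ c₁≡c₃) toℕ-c₃)
    c₁≢c₂ : c₁ ≢ c₂
    c₁≢c₂ c₁≡c₂ = ℕ.m≢1+n+m (toℕ c₁) (trans (cong toℕ c₁≡c₂) gap)

det-equalColumns : ∀ n (M : Matrix n) {c₁ c₂ : Fin n} → c₁ ≢ c₂ → (∀ r → M r c₁ ≡ M r c₂) → det n M ≡ 0ℤ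
det-equalColumns n M {c₁} {c₂} c₁≢c₂ eq with ℕ.<-cmp (toℕ c₁) (toℕ c₂)
... | tri< c₁<c₂ _ _ = det-equalColumns-gap n _ M (trans (sym (ℕ.m∸n+n≡m c₁<c₂)) (ℕ.+-suc _ _)) eq
... | tri≈ _ c₁≡c₂ _ = ⊥-elim (c₁≢c₂ (Fin.toℕ-injective c₁≡c₂))
... | tri> _ _ c₂<c₁ = det-equalColumns-gap n _ M (trans (sym (ℕ.m∸n+n≡m c₂<c₁)) (ℕ.+-suc _ _)) (sym ∘ eq)

det-setColumn-combination : ∀ n (M : Matrix n) k (u : Fin n → ℤ) →
  det n (setColumn M k (λ r → ∑ n (λ m → u m * M r m))) ≡ u k * det n M
det-setColumn-combination n M k u = begin
  det n (setColumn M k (λ r → ∑ n (λ m → u m * M r m)))   ≡⟨ det-setColumn-∑ n M k n u (λ m r → M r m) ⟩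
  ∑ n (λ m → u m * det n (setColumn M k (λ r → M r m)))  ≡⟨ ∑-single n _ k vanish ⟩
  u k * det n (setColumn M k (λ r → M r k))              ≡⟨ cong (u k *_) (det-cong n (λ r → updateAt-id-local k (M r) refl)) ⟩
  u k * det n M                                          ∎
  where
  vanish : ∀ m → m ≢ k → u m * det n (setColumn M k (λ r → M r m)) ≡ 0ℤ
  vanish m m≢k = begin
    u m * det n (setColumn M k (λ r → M r m))  ≡⟨ cong (u m *_) (det-equalColumns n _ m≢k equal) ⟩
    u m * 0ℤ                                   ≡⟨ ℤ.*-zeroʳ (u m) ⟩
    0ℤ                                         ∎
    where
    equal : ∀ r → setColumn M k (λ r → M r m) r m ≡ setColumn M k (λ r → M r m) r k
    equal r = trans (updateAt-minimal m k (M r) m≢k) (sym (updateAt-updates k (M r)))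

_*ᴹ_ : ∀ {n} → Matrix n → Matrix n → Matrix n
(_*ᴹ_ {n} A B) i j = ∑ n (λ m → A i m * B m j)

UpperTriangular : ∀ {n} → Matrix n → Set
UpperTriangular U = ∀ i j → toℕ j ℕ.< toℕ i → U i j ≡ 0ℤ

LowerTriangular : ∀ {n} → Matrix n → Set
LowerTriangular M = ∀ i j → toℕ i ℕ.< toℕ j → M i j ≡ 0ℤ

module _ {n} (N U : Matrix n) where

  spliceColumns : ℕ → Matrix n
  spliceColumns t r x with toℕ x ℕ.<? t
  ... | yes _ = N r x
  ... | no  _ = (N *ᴹ U) r x

  spliceColumns-< : ∀ {t} r x → toℕ x ℕ.< t → spliceColumns t r x ≡ N r x
  spliceColumns-< {t} r x x<t with toℕ x ℕ.<? t
  ... | yes _  = refl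
  ... | no x≮t = ⊥-elim (x≮t x<t)

  spliceColumns-≮ : ∀ {t} r x → ¬ toℕ x ℕ.< t → spliceColumns t r x ≡ (N *ᴹ U) r x
  spliceColumns-≮ {t} r x x≮t with toℕ x ℕ.<? t
  ... | yes x<t = ⊥-elim (x≮t x<t)
  ... | no _    = refl

  -- Column t of N *ᴹ U is column t of N plus a combination of the columns of N before t.
  spliceColumns-suc : UpperTriangular U → ∀ {t} (t<n : t ℕ.< n) → ∀ r x →
    spliceColumns t r x ≡
    setColumn (spliceColumns (suc t)) (fromℕ< t<n) (λ r → ∑ n (λ m → U m (fromℕ< t<n) * spliceColumns (suc t) r m)) r x
  spliceColumns-suc U-upper {t} t<n r x with x Fin.≟ fromℕ< t<n
  ... | yes refl = begin
    spliceColumns t r k                            ≡⟨ spliceColumns-≮ r k (ℕ.<-irrefl toℕ-k) ⟩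
    ∑ n (λ m → N r m * U m k)                      ≡⟨ ∑-cong n (λ m → term m (toℕ m ℕ.<? suc t)) ⟩
    ∑ n (λ m → U m k * spliceColumns (suc t) r m)  ≡⟨ updateAt-updates k (spliceColumns (suc t) r) ⟨
    setColumn (spliceColumns (suc t)) k (λ r → ∑ n (λ m → U m k * spliceColumns (suc t) r m)) r k ∎
    where
    k = fromℕ< t<n
    toℕ-k : toℕ k ≡ t
    toℕ-k = Fin.toℕ-fromℕ< t<n
    term : ∀ m → Dec (toℕ m ℕ.< suc t) → N r m * U m k ≡ U m k * spliceColumns (suc t) r m
    term m (yes m≤t) = trans (ℤ.*-comm (N r m) (U m k)) (cong (U m k *_) (sym (spliceColumns-< r m m≤t)))
    term m (no m≰t)  = begin
      N r m * U m k                      ≡⟨ cong (N r m *_) U-mk≡0 ⟩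
      N r m * 0ℤ                         ≡⟨ ℤ.*-zeroʳ (N r m) ⟩
      0ℤ                                 ≡⟨ cong (_* spliceColumns (suc t) r m) U-mk≡0 ⟨
      U m k * spliceColumns (suc t) r m  ∎
      where
      U-mk≡0 : U m k ≡ 0ℤ
      U-mk≡0 = U-upper m k (subst (ℕ._< toℕ m) (sym toℕ-k) (ℕ.≮⇒≥ m≰t))
  ... | no x≢k = trans (unchanged (toℕ x ℕ.<? t)) (sym (updateAt-minimal x (fromℕ< t<n) (spliceColumns (suc t) r) x≢k))
    where
    unchanged : Dec (toℕ x ℕ.< t) → spliceColumns t r x ≡ spliceColumns (suc t) r x
    unchanged (yes x<t) = trans (spliceColumns-< r x x<t) (sym (spliceColumns-< r x (ℕ.m<n⇒m<1+n x<t)))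
    unchanged (no x≮t)  = trans (spliceColumns-≮ r x x≮t) (sym (spliceColumns-≮ r x x≮1+t))
      where
      x≮1+t : ¬ toℕ x ℕ.< suc t
      x≮1+t x<1+t = x≢k (Fin.toℕ-injective
        (trans (ℕ.≤-antisym (ℕ.≤-pred x<1+t) (ℕ.≮⇒≥ x≮t)) (sym (Fin.toℕ-fromℕ< t<n))))

  det-spliceColumns-suc : UpperTriangular U → (∀ i → U i i ≡ 1ℤ) → ∀ {t} (t<n : t ℕ.< n) →
    det n (spliceColumns t) ≡ det n (spliceColumns (suc t))
  det-spliceColumns-suc U-upper U-diag {t} t<n = begin
    det n (spliceColumns t)
      ≡⟨ det-cong n (spliceColumns-suc U-upper t<n) ⟩
    det n (setColumn (spliceColumns (suc t)) k (λ r → ∑ n (λ m → U m k * spliceColumns (suc t) r m)))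
      ≡⟨ det-setColumn-combination n (spliceColumns (suc t)) k (λ m → U m k) ⟩
    U k k * det n (spliceColumns (suc t))  ≡⟨ cong (_* det n (spliceColumns (suc t))) (U-diag k) ⟩
    1ℤ * det n (spliceColumns (suc t))     ≡⟨ ℤ.*-identityˡ _ ⟩
    det n (spliceColumns (suc t))          ∎
    where
    k = fromℕ< t<n

det-*ᴹ-upperUnitriangular : ∀ n (N U : Matrix n) → UpperTriangular U → (∀ i → U i i ≡ 1ℤ) →
  det n (N *ᴹ U) ≡ det n N
det-*ᴹ-upperUnitriangular n N U U-upper U-diag = begin
  det n (N *ᴹ U)                 ≡⟨ det-cong n (λ r x → spliceColumns-≮ N U {0} r x λ ()) ⟨
  det n (spliceColumns N U 0)    ≡⟨ prefix n ℕ.≤-refl ⟩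
  det n (spliceColumns N U n)    ≡⟨ det-cong n (λ r x → spliceColumns-< N U r x (Fin.toℕ<n x)) ⟩
  det n N                        ∎
  where
  prefix : ∀ t → t ℕ.≤ n → det n (spliceColumns N U 0) ≡ det n (spliceColumns N U t)
  prefix zero    _   = refl
  prefix (suc t) t<n = trans (prefix t (ℕ.<⇒≤ t<n)) (det-spliceColumns-suc N U U-upper U-diag t<n)

det-lowerTriangular : ∀ n (M : Matrix n) → LowerTriangular M → det n M ≡ ∏ (λ (i : Fin n) → M i i)
det-lowerTriangular zero    M _     = refl
det-lowerTriangular (suc n) M lower = begin
  laplaceTerm M zero + ∑ n (laplaceTerm M ∘ suc)   ≡⟨ cong (_+_ (laplaceTerm M zero)) (∑-zero n off-diagonal) ⟩
  laplaceTerm M zero + 0ℤ                          ≡⟨ ℤ.+-identityʳ _ ⟩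
  1ℤ * (M zero zero * det n (minor M zero))        ≡⟨ ℤ.*-identityˡ _ ⟩
  M zero zero * det n (minor M zero)               ≡⟨ cong (M zero zero *_) (det-lowerTriangular n (minor M zero) lower′) ⟩
  M zero zero * ∏ (λ (i : Fin n) → M (suc i) (suc i)) ∎
  where
  off-diagonal : ∀ j → laplaceTerm M (suc j) ≡ 0ℤ
  off-diagonal j = begin
    sgn (toℕ (suc j)) * (M zero (suc j) * det n (minor M (suc j)))
      ≡⟨ cong (λ x → sgn (toℕ (suc j)) * (x * det n (minor M (suc j)))) (lower zero (suc j) ℕ.z<s) ⟩
    sgn (toℕ (suc j)) * 0ℤ                                          ≡⟨ ℤ.*-zeroʳ (sgn (toℕ (suc j))) ⟩
    0ℤ                                                              ∎
  lower′ : LowerTriangular (minor M zero)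
  lower′ i j i<j = lower (suc i) (suc j) (ℕ.s<s i<j)

∏-powers : ∀ (x y : ℤ) n → ∏ (λ (i : Fin n) → x * y ^ suc (toℕ i)) ≡ x ^ n * y ^ (suc n C 2)
∏-powers x y zero    = refl
∏-powers x y (suc n) = begin
  ∏ f                                          ≡⟨ ∏-init-last f ⟩
  ∏ (f ∘ inject₁) * f (fromℕ n)
    ≡⟨ cong₂ _*_ (trans (∏-cong {n} (λ i → cong (λ k → x * y ^ suc k) (Fin.toℕ-inject₁ i))) (∏-powers x y n))
                                                           (cong (λ k → x * y ^ suc k) (Fin.toℕ-fromℕ n)) ⟩
  x ^ n * y ^ (suc n C 2) * (x * y ^ suc n)    ≡⟨ regroup (x ^ n) (y ^ (suc n C 2)) x (y ^ suc n) ⟩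
  x ^ suc n * (y ^ suc n * y ^ (suc n C 2))    ≡⟨ cong (x ^ suc n *_) (ℤ.^-distribˡ-+-* y (suc n) (suc n C 2)) ⟨
  x ^ suc n * y ^ (suc n ℕ.+ suc n C 2)        ≡⟨ cong (λ k → x ^ suc n * y ^ (k ℕ.+ suc n C 2)) (nC1≡n (suc n)) ⟨
  x ^ suc n * y ^ (suc n C 1 ℕ.+ suc n C 2)    ≡⟨ cong (λ k → x ^ suc n * y ^ k) (nCk+nC[k+1]≡[n+1]C[k+1] (suc n) 1) ⟩
  x ^ suc n * y ^ (suc (suc n) C 2)            ∎
  where
  f : Fin (suc n) → ℤ
  f i = x * y ^ suc (toℕ i)
  regroup : ∀ a b x c → a * b * (x * c) ≡ x * a * (c * b)
  regroup = solve-∀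

-- The coefficients c i m and the Jacobi operator J

+C-pascal : ∀ n k → + (suc n C suc k) ≡ + (n C k) + + (n C suc k)
+C-pascal n k = trans (cong +_ (sym (nCk+nC[k+1]≡[n+1]C[k+1] n k))) (ℤ.pos-+ (n C k) (n C suc k))

+C-vanish : ∀ {n k} → n ℕ.< k → + (n C k) ≡ 0ℤ
+C-vanish n<k = cong +_ (k>n⇒nCk≡0 n<k)

module _ (r : ℤ) where

  -- G p q m is the coefficient of x^m in (1 + x)^p (1 + r/x)^q.
  G-term : ℕ → ℕ → ℕ → ℕ → ℤ
  G-term p q m b = + (p C (m ℕ.+ b)) * (+ (q C b) * r ^ b)

  G : ℕ → ℕ → ℕ → ℤ
  G p q m = ∑≤ q (G-term p q m)

  G-suc-p : ∀ p q m → G (suc p) q (suc m) ≡ G p q (suc m) + G p q m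
  G-suc-p p q m = trans (∑-cong (suc q) (term ∘ toℕ)) (∑-distrib-+ (suc q) (G-term p q (suc m) ∘ toℕ) (G-term p q m ∘ toℕ))
    where
    term : ∀ b → G-term (suc p) q (suc m) b ≡ G-term p q (suc m) b + G-term p q m b
    term b = begin
      + (suc p C suc (m ℕ.+ b)) * X                        ≡⟨ cong (_* X) (+C-pascal p (m ℕ.+ b)) ⟩
      (+ (p C (m ℕ.+ b)) + + (p C suc (m ℕ.+ b))) * X      ≡⟨ ℤ.*-distribʳ-+ X (+ (p C (m ℕ.+ b))) (+ (p C suc (m ℕ.+ b))) ⟩
      + (p C (m ℕ.+ b)) * X + + (p C suc (m ℕ.+ b)) * X    ≡⟨ ℤ.+-comm (+ (p C (m ℕ.+ b)) * X) _ ⟩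
      + (p C suc (m ℕ.+ b)) * X + + (p C (m ℕ.+ b)) * X    ∎
      where X = + (q C b) * r ^ b

  G-suc-q : ∀ p q m → G p (suc q) m ≡ G p q m + r * G p q (suc m)
  G-suc-q p q m = begin
    G-term p (suc q) m 0 + ∑≤ q (λ b → G-term p (suc q) m (suc b))
      ≡⟨ cong (_+_ (G-term p q m 0)) (trans (∑-cong (suc q) (term ∘ toℕ))
                                             (∑-distrib-+ (suc q) (G-term p q m ∘ suc ∘ toℕ) (λ b → r * G-term p q (suc m) (toℕ b)))) ⟩
    G-term p q m 0 + (∑≤ q (G-term p q m ∘ suc) + ∑≤ q (λ b → r * G-term p q (suc m) b))
      ≡⟨ ℤ.+-assoc (G-term p q m 0) (∑≤ q (G-term p q m ∘ suc)) _ ⟨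
    G-term p q m 0 + ∑≤ q (G-term p q m ∘ suc) + ∑≤ q (λ b → r * G-term p q (suc m) b)
      ≡⟨ cong₂ _+_ (cong (_+_ (G-term p q m 0)) (∑-dropLast q (G-term p q m ∘ suc) last-vanishes))
                   (sym (*-distribˡ-∑ (suc q) r (G-term p q (suc m) ∘ toℕ))) ⟩
    G p q m + r * G p q (suc m) ∎
    where
    last-vanishes : G-term p q m (suc q) ≡ 0ℤ
    last-vanishes = trans (cong (λ x → + (p C (m ℕ.+ suc q)) * (x * r ^ suc q)) (+C-vanish (ℕ.n<1+n q)))
                          (ℤ.*-zeroʳ (+ (p C (m ℕ.+ suc q))))
    split : ∀ r A x y R → A * ((x + y) * (r * R)) ≡ A * (y * (r * R)) + r * (A * (x * R))
    split = solve-∀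
    term : ∀ b → G-term p (suc q) m (suc b) ≡ G-term p q m (suc b) + r * G-term p q (suc m) b
    term b = begin
      + (p C (m ℕ.+ suc b)) * (+ (suc q C suc b) * (r * r ^ b))
        ≡⟨ cong (λ x → + (p C (m ℕ.+ suc b)) * (x * (r * r ^ b))) (+C-pascal q b) ⟩
      + (p C (m ℕ.+ suc b)) * ((+ (q C b) + + (q C suc b)) * (r * r ^ b))
        ≡⟨ split r (+ (p C (m ℕ.+ suc b))) (+ (q C b)) (+ (q C suc b)) (r ^ b) ⟩
      G-term p q m (suc b) + r * (+ (p C (m ℕ.+ suc b)) * (+ (q C b) * r ^ b))
        ≡⟨ cong (λ k → G-term p q m (suc b) + r * (+ (p C k) * (+ (q C b) * r ^ b))) (ℕ.+-suc m b) ⟩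
      G-term p q m (suc b) + r * G-term p q (suc m) b ∎

  -- The missing case m = -1 of G-suc-p: ((1 + x) (1 + r/x))^p is invariant under x ↦ r/x, so its
  -- coefficient of x^(-1) is r times its coefficient of x.
  G-suc-p-zero : ∀ p → G (suc p) p 0 ≡ G p p 0 + r * G p p 1
  G-suc-p-zero p = begin
    G-term p p 0 0 + ∑ p (G-term (suc p) p 0 ∘ suc ∘ toℕ)
      ≡⟨ cong (_+_ (G-term p p 0 0)) (trans (∑-cong p (term ∘ toℕ))
                                       (∑-distrib-+ p (G-term p p 0 ∘ suc ∘ toℕ) (λ b → r * G-term p p 1 (toℕ b)))) ⟩
    G-term p p 0 0 + (∑ p (G-term p p 0 ∘ suc ∘ toℕ) + ∑ p (λ b → r * G-term p p 1 (toℕ b)))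
      ≡⟨ ℤ.+-assoc (G-term p p 0 0) (∑ p (G-term p p 0 ∘ suc ∘ toℕ)) _ ⟨
    G p p 0 + ∑ p (λ b → r * G-term p p 1 (toℕ b))
      ≡⟨ cong (_+_ (G p p 0)) (*-distribˡ-∑ p r (G-term p p 1 ∘ toℕ)) ⟨
    G p p 0 + r * ∑ p (G-term p p 1 ∘ toℕ)
      ≡⟨ cong (λ x → G p p 0 + r * x) (∑-dropLast p (G-term p p 1) last-vanishes) ⟨
    G p p 0 + r * G p p 1 ∎
    where
    last-vanishes : G-term p p 1 p ≡ 0ℤ
    last-vanishes = cong (_* (+ (p C p) * r ^ p)) (+C-vanish (ℕ.n<1+n p))
    split : ∀ r x y R → (x + y) * (y * (r * R)) ≡ y * (y * (r * R)) + r * (y * (x * R))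
    split = solve-∀
    term : ∀ b → G-term (suc p) p 0 (suc b) ≡ G-term p p 0 (suc b) + r * G-term p p 1 b
    term b = begin
      + (suc p C suc b) * (+ (p C suc b) * (r * r ^ b))
        ≡⟨ cong (_* (+ (p C suc b) * (r * r ^ b))) (+C-pascal p b) ⟩
      (+ (p C b) + + (p C suc b)) * (+ (p C suc b) * (r * r ^ b))
        ≡⟨ split r (+ (p C b)) (+ (p C suc b)) (r ^ b) ⟩
      G-term p p 0 (suc b) + r * G-term p p 1 b ∎

  c : ℕ → ℕ → ℤ
  c i = G i i

  w : ℕ → ℤ
  w zero    = 1ℤ
  w (suc m) = + 2 * r ^ suc m

  β : ℕ → ℤ
  β zero    = + 2 * r
  β (suc m) = r

  w-β : ∀ m → w m * β m ≡ w (suc m)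
  w-β zero    = trans (ℤ.*-identityˡ (+ 2 * r)) (cong (λ x → + 2 * x) (sym (ℤ.*-identityʳ r)))
  w-β (suc m) = regroup (+ 2) (r ^ suc m) r
    where
    regroup : ∀ x R r → x * R * r ≡ x * (r * R)
    regroup = solve-∀

  shift : (ℕ → ℤ) → ℕ → ℤ
  shift v zero    = 0ℤ
  shift v (suc m) = v m

  J : (ℕ → ℤ) → ℕ → ℤ
  J v m = shift v m + (1ℤ + r) * v m + β m * v (suc m)

  c-J : ∀ i m → c (suc i) m ≡ J (c i) m
  c-J i zero = begin
    G (suc i) (suc i) 0                              ≡⟨ G-suc-q (suc i) i 0 ⟩
    G (suc i) i 0 + r * G (suc i) i 1                ≡⟨ cong₂ (λ x y → x + r * y) (G-suc-p-zero i) (G-suc-p i i 0) ⟩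
    c i 0 + r * c i 1 + r * (c i 1 + c i 0)          ≡⟨ collect r (c i 0) (c i 1) ⟩
    0ℤ + (1ℤ + r) * c i 0 + (+ 2 * r) * c i 1        ∎
    where
    collect : ∀ r x y → x + r * y + r * (y + x) ≡ 0ℤ + (1ℤ + r) * x + (+ 2 * r) * y
    collect = solve-∀
  c-J i (suc m) = begin
    G (suc i) (suc i) (suc m)                                    ≡⟨ G-suc-q (suc i) i (suc m) ⟩
    G (suc i) i (suc m) + r * G (suc i) i (suc (suc m))          ≡⟨ cong₂ (λ x y → x + r * y) (G-suc-p i i m) (G-suc-p i i (suc m)) ⟩
    c i (suc m) + c i m + r * (c i (suc (suc m)) + c i (suc m))  ≡⟨ collect r (c i m) (c i (suc m)) (c i (suc (suc m))) ⟩
    c i m + (1ℤ + r) * c i (suc m) + r * c i (suc (suc m))       ∎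
    where
    collect : ∀ r x y z → y + x + r * (z + y) ≡ x + (1ℤ + r) * y + r * z
    collect = solve-∀

  c-vanish : ∀ {i m} → i ℕ.< m → c i m ≡ 0ℤ
  c-vanish {i} {m} i<m = ∑-zero (suc i) λ b →
    cong (_* (+ (i C toℕ b) * r ^ toℕ b)) (+C-vanish (ℕ.<-≤-trans i<m (ℕ.m≤m+n m (toℕ b))))

  c-diag : ∀ i → c i i ≡ 1ℤ
  c-diag i = cong₂ _+_ (cong (λ k → + k * 1ℤ) (trans (cong (i C_) (ℕ.+-identityʳ i)) (nCn≡1 i)))
                       (∑-zero i (λ b → cong (_* (+ (i C suc (toℕ b)) * r ^ suc (toℕ b))) (+C-vanish (ℕ.m<m+n i ℕ.z<s))))

  a≡c₀ : ∀ n → a r n ≡ c n 0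
  a≡c₀ n = cong (λ k → ∑≤ k (λ j → + (n C j) * (+ (k C j) * r ^ j))) (trans (ℕ.m+n∸m≡n n (n ℕ.+ 0)) (ℕ.+-identityʳ n))

  pairing : ℕ → (ℕ → ℤ) → (ℕ → ℤ) → ℤ
  pairing K u v = ∑≤ K (λ m → w m * u m * v m)

  cross : ℕ → (ℕ → ℤ) → (ℕ → ℤ) → ℤ
  cross K u v = ∑ K (λ i → w (suc (toℕ i)) * u (suc (toℕ i)) * v (toℕ i))

  pairing-cong : ∀ K {u u′ v v′ : ℕ → ℤ} → u ≗ u′ → v ≗ v′ → pairing K u v ≡ pairing K u′ v′
  pairing-cong K u≗u′ v≗v′ = ∑-cong (suc K) (λ i → cong₂ (λ x y → w (toℕ i) * x * y) (u≗u′ (toℕ i)) (v≗v′ (toℕ i)))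

  pairing-sym : ∀ K u v → pairing K u v ≡ pairing K v u
  pairing-sym K u v = ∑-cong (suc K) (λ i → swap (w (toℕ i)) (u (toℕ i)) (v (toℕ i)))
    where
    swap : ∀ w x y → w * x * y ≡ w * y * x
    swap = solve-∀

  pairing-J : ∀ K u v → v (suc K) ≡ 0ℤ →
    pairing K u (J v) ≡ (1ℤ + r) * pairing K u v + (cross K u v + cross K v u)
  pairing-J K u v v-vanishes = begin
    pairing K u (J v)                                   ≡⟨ ∑-cong (suc K) (term ∘ toℕ) ⟩
    ∑≤ K (λ m → down m + diagonal m + up m)             ≡⟨ ∑-distrib-+ (suc K) (λ m → down (toℕ m) + diagonal (toℕ m)) (up ∘ toℕ) ⟩
    ∑≤ K (λ m → down m + diagonal m) + ∑≤ K up          ≡⟨ cong (_+ ∑≤ K up) (∑-distrib-+ (suc K) (down ∘ toℕ) (diagonal ∘ toℕ)) ⟩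
    ∑≤ K down + ∑≤ K diagonal + ∑≤ K up
      ≡⟨ cong₂ _+_ (cong₂ _+_ down-sum (sym (*-distribˡ-∑ (suc K) (1ℤ + r) (λ m → w (toℕ m) * u (toℕ m) * v (toℕ m)))))
                   (∑-dropLast K up up-last) ⟩
    cross K u v + (1ℤ + r) * pairing K u v + cross K v u  ≡⟨ rearrange (cross K u v) ((1ℤ + r) * pairing K u v) (cross K v u) ⟩
    (1ℤ + r) * pairing K u v + (cross K u v + cross K v u) ∎
    where
    down diagonal up : ℕ → ℤ
    down m     = w m * u m * shift v m
    diagonal m = (1ℤ + r) * (w m * u m * v m)
    up m       = w (suc m) * v (suc m) * u m
    distribute : ∀ W U s t x b y → W * U * (s + t * x + b * y) ≡ W * U * s + t * (W * U * x) + W * b * y * U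
    distribute = solve-∀
    term : ∀ m → w m * u m * J v m ≡ down m + diagonal m + up m
    term m = trans (distribute (w m) (u m) (shift v m) (1ℤ + r) (v m) (β m) (v (suc m)))
                   (cong (λ x → down m + diagonal m + x * v (suc m) * u m) (w-β m))
    down-sum : ∑≤ K down ≡ cross K u v
    down-sum = trans (cong (_+ cross K u v) (ℤ.*-zeroʳ (1ℤ * u 0))) (ℤ.+-identityˡ (cross K u v))
    up-last : up K ≡ 0ℤ
    up-last = begin
      w (suc K) * v (suc K) * u K  ≡⟨ cong (λ x → w (suc K) * x * u K) v-vanishes ⟩
      w (suc K) * 0ℤ * u K         ≡⟨ cong (_* u K) (ℤ.*-zeroʳ (w (suc K))) ⟩
      0ℤ                           ∎
    rearrange : ∀ x y z → x + y + z ≡ y + (x + z)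
    rearrange = solve-∀

  J-selfAdjoint : ∀ K u v → u (suc K) ≡ 0ℤ → v (suc K) ≡ 0ℤ → pairing K u (J v) ≡ pairing K (J u) v
  J-selfAdjoint K u v u-vanishes v-vanishes = begin
    pairing K u (J v)                                      ≡⟨ pairing-J K u v v-vanishes ⟩
    (1ℤ + r) * pairing K u v + (cross K u v + cross K v u)
      ≡⟨ cong₂ (λ x y → (1ℤ + r) * x + y) (pairing-sym K u v) (ℤ.+-comm (cross K u v) _) ⟩
    (1ℤ + r) * pairing K v u + (cross K v u + cross K u v)  ≡⟨ pairing-J K v u u-vanishes ⟨
    pairing K v (J u)                                      ≡⟨ pairing-sym K v (J u) ⟩
    pairing K (J u) v                                      ∎

  pairing-c-shift : ∀ K {i j} → i ℕ.≤ K → j ℕ.≤ K → pairing K (c i) (c (suc j)) ≡ pairing K (c (suc i)) (c j)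
  pairing-c-shift K {i} {j} i≤K j≤K = begin
    pairing K (c i) (c (suc j))   ≡⟨ pairing-cong K {c i} (λ _ → refl) (c-J j) ⟩
    pairing K (c i) (J (c j))     ≡⟨ J-selfAdjoint K (c i) (c j) (c-vanish (ℕ.s≤s i≤K)) (c-vanish (ℕ.s≤s j≤K)) ⟩
    pairing K (J (c i)) (c j)     ≡⟨ pairing-cong K {v = c j} (c-J i) (λ _ → refl) ⟨
    pairing K (c (suc i)) (c j)   ∎

  pairing-c : ∀ K i j → i ℕ.+ j ℕ.≤ K → pairing K (c i) (c j) ≡ c (i ℕ.+ j) 0
  pairing-c K i zero _ = begin
    1ℤ * c i 0 * c 0 0 + ∑ K (λ m → w (suc (toℕ m)) * c i (suc (toℕ m)) * c 0 (suc (toℕ m)))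
      ≡⟨ cong₂ _+_ (cong (1ℤ * c i 0 *_) (c-diag 0)) (∑-zero K (beyond-0 ∘ toℕ)) ⟩
    1ℤ * c i 0 * 1ℤ + 0ℤ   ≡⟨ drop-units (c i 0) ⟩
    c i 0                  ≡⟨ cong (λ k → c k 0) (ℕ.+-identityʳ i) ⟨
    c (i ℕ.+ 0) 0          ∎
    where
    beyond-0 : ∀ m → w (suc m) * c i (suc m) * c 0 (suc m) ≡ 0ℤ
    beyond-0 m = trans (cong (w (suc m) * c i (suc m) *_) (c-vanish {m = suc m} ℕ.z<s)) (ℤ.*-zeroʳ (w (suc m) * c i (suc m)))
    drop-units : ∀ x → 1ℤ * x * 1ℤ + 0ℤ ≡ x
    drop-units = solve-∀
  pairing-c K i (suc j) i+j≤K = begin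
    pairing K (c i) (c (suc j))   ≡⟨ pairing-c-shift K i≤K j≤K ⟩
    pairing K (c (suc i)) (c j)   ≡⟨ pairing-c K (suc i) j (subst (ℕ._≤ K) (ℕ.+-suc i j) i+j≤K) ⟩
    c (suc i ℕ.+ j) 0             ≡⟨ cong (λ k → c k 0) (ℕ.+-suc i j) ⟨
    c (i ℕ.+ suc j) 0             ∎
    where
    i≤K : i ℕ.≤ K
    i≤K = ℕ.≤-trans (ℕ.m≤m+n i (suc j)) i+j≤K
    j≤K : j ℕ.≤ K
    j≤K = ℕ.≤-trans (ℕ.n≤1+n j) (ℕ.≤-trans (ℕ.m≤n+m (suc j) i) i+j≤K)

  a≡pairing : ∀ n {i j} → i ℕ.≤ n → j ℕ.≤ n → a r (i ℕ.+ j) ≡ pairing n (c i) (c j)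
  a≡pairing n {i} {j} i≤n j≤n = begin
    a r (i ℕ.+ j)                ≡⟨ a≡c₀ (i ℕ.+ j) ⟩
    c (i ℕ.+ j) 0                ≡⟨ pairing-c (n ℕ.+ n) i j (ℕ.+-mono-≤ i≤n j≤n) ⟨
    pairing (n ℕ.+ n) (c i) (c j)  ≡⟨ ∑-truncate (suc n) n (λ m → w m * c i m * c j m) beyond-n ⟩
    pairing n (c i) (c j)        ∎
    where
    beyond-n : ∀ m → suc n ℕ.≤ m → w m * c i m * c j m ≡ 0ℤ
    beyond-n m n<m = cong (_* c j m) (trans (cong (w m *_) (c-vanish (ℕ.<-≤-trans (ℕ.s≤s i≤n) n<m))) (ℤ.*-zeroʳ (w m)))

mainTheorem1 : (r : ℤ) (n : ℕ) →
    hankel (a r) n ≡ (+ 2) ^ n * r ^ (suc n C 2)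
mainTheorem1 r n = begin
  det (suc n) (λ i j → a r (toℕ i ℕ.+ toℕ j))
    ≡⟨ det-cong (suc n) (λ i j → a≡pairing r n (Fin.toℕ≤pred[n] i) (Fin.toℕ≤pred[n] j)) ⟩
  det (suc n) (L *ᴹ U)
    ≡⟨ det-*ᴹ-upperUnitriangular (suc n) L U (λ _ _ → c-vanish r) (c-diag r ∘ toℕ) ⟩
  det (suc n) L
    ≡⟨ det-lowerTriangular (suc n) L L-lower ⟩
  ∏ (λ (i : Fin (suc n)) → L i i)
    ≡⟨ ∏-cong {suc n} (λ i → trans (cong (w r (toℕ i) *_) (c-diag r (toℕ i))) (ℤ.*-identityʳ (w r (toℕ i)))) ⟩
  ∏ {suc n} (w r ∘ toℕ)
    ≡⟨ ℤ.*-identityˡ (∏ (λ (i : Fin n) → + 2 * r ^ suc (toℕ i))) ⟩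
  ∏ (λ (i : Fin n) → + 2 * r ^ suc (toℕ i))
    ≡⟨ ∏-powers (+ 2) r n ⟩
  (+ 2) ^ n * r ^ (suc n C 2) ∎
  where
  L U : Matrix (suc n)
  L i m = w r (toℕ m) * c r (toℕ i) (toℕ m)
  U m j = c r (toℕ j) (toℕ m)
  L-lower : LowerTriangular L
  L-lower i m i<m = trans (cong (w r (toℕ m) *_) (c-vanish r i<m)) (ℤ.*-zeroʳ (w r (toℕ m)))
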